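{- A $2$-edge-coloured graph $G=(\Gamma,R,B)$ is chromatically invariant if and only if for every pair of disjoint non-empty independent sets $I_1,I_2$ of $\Gamma$, the $2$-edge-coloured subgraph of $G$ induced by $I_1\cup I_2$ is monochromatic.
   Context: All graphs are finite and simple. A $2$-edge-coloured graph is a triple $G=(\Gamma,R,B)$ with $R,B\subseteq E(\Gamma)$, $R\cap B=\emptyset$, $R\cup B=E(\Gamma)$ (red and blue edges). It is monochromatic if $R=\emptyset$ or $B=\emptyset$; induced subgraphs inherit the colours of their edges. A $k$-colouring of $G$ is a proper vertex colouring $c:V(\Gamma)\to\{1,\dots,k\}$ of $\Gamma$ such that for every $ux\in R$ and $vy\in B$ (either endpoint may play the role of $u$, resp. $v$), $c(u)=c(v)$ implies $c(x)\ne c(y)$. $P(G,\lambda)$ is the polynomial whose value at each non-negative integer $k$ is the number of $k$-colourings of $G$. $G$ is chromatically invariant if $P(G,\lambda)=P(\Gamma,\lambda)$, the usual chromatic polynomial of $\Gamma$. -}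

module Defs where

open import Data.Nat using (ℕ; zero; suc)
open import Data.Bool using (Bool; true; false; _∨_)
open import Data.Fin using (Fin; _≟_)
open import Data.Fin.Subset using (Subset; _∈_; Nonempty; _∪_; _∩_; Empty)
open import Data.Fin.Properties using (all?)
open import Data.List using (List; []; _∷_; map; concatMap; filter; length; allFin)
open import Data.Vec.Functional as VF using ()
open import Data.Product using (_×_; _,_)
open import Data.Sum using (_⊎_)
open import Relation.Nullary using (¬_; Dec; yes; no)
open import Relation.Nullary.Decidable using (¬?; _→-dec_)
open import Relation.Binary.PropositionalEquality using (_≡_; _≢_)
open import Data.Bool.Properties using () renaming (_≟_ to _≟ᵇ_)

-- A finite simple 2-edge-coloured graph on vertex set Fin n.
-- red / blue are the (symmetric, loopless, disjoint) edge relations R and B;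
-- the underlying simple graph Γ has edge set R ∪ B.
record TwoEdgeColouredGraph (n : ℕ) : Set where
  field
    red       : Fin n → Fin n → Bool
    blue      : Fin n → Fin n → Bool
    red-sym   : ∀ x y → red x y ≡ red y x
    blue-sym  : ∀ x y → blue x y ≡ blue y x
    red-irr   : ∀ x → red x x ≡ false
    blue-irr  : ∀ x → blue x x ≡ false
    disjoint  : ∀ x y → red x y ≡ true → blue x y ≡ false

open TwoEdgeColouredGraph public

edge : ∀ {n} → TwoEdgeColouredGraph n → Fin n → Fin n → Bool
edge G x y = red G x y ∨ blue G x y

Proper : ∀ {n k} → TwoEdgeColouredGraph n → (Fin n → Fin k) → Set
Proper G c = ∀ x y → edge G x y ≡ true → c x ≢ c y

IsColouring : ∀ {n k} → TwoEdgeColouredGraph n → (Fin n → Fin k) → Set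
IsColouring G c =
  Proper G c ×
  (∀ u x v y → red G u x ≡ true → blue G v y ≡ true → c u ≡ c v → c x ≢ c y)

proper? : ∀ {n k} (G : TwoEdgeColouredGraph n) (c : Fin n → Fin k) → Dec (Proper G c)
proper? G c = all? λ x → all? λ y → (edge G x y ≟ᵇ true) →-dec ¬? (c x ≟ c y)

isColouring? : ∀ {n k} (G : TwoEdgeColouredGraph n) (c : Fin n → Fin k) → Dec (IsColouring G c)
isColouring? G c with proper? G c
... | no ¬p = no λ { (p , _) → ¬p p }
... | yes p with (all? λ u → all? λ x → all? λ v → all? λ y →
                   (red G u x ≟ᵇ true) →-dec ((blue G v y ≟ᵇ true) →-dec
                   ((c u ≟ c v) →-dec ¬? (c x ≟ c y))))
...   | yes q = yes (p , q)
...   | no ¬q = no λ { (_ , q) → ¬q q }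

allFuns : ∀ n k → List (Fin n → Fin k)
allFuns zero    k = (λ ()) ∷ []
allFuns (suc n) k = concatMap (λ i → map (λ f → i VF.∷ f) (allFuns n k)) (allFin k)

P₂ : ∀ {n} → TwoEdgeColouredGraph n → ℕ → ℕ
P₂ {n} G k = length (filter (isColouring? G) (allFuns n k))

PΓ : ∀ {n} → TwoEdgeColouredGraph n → ℕ → ℕ
PΓ {n} G k = length (filter (proper? G) (allFuns n k))

-- chromatically invariant: P(G,λ) = P(Γ,λ); polynomials are determined by
-- their values at all non-negative integers, so this is equality at every k.
ChromaticallyInvariant : ∀ {n} → TwoEdgeColouredGraph n → Set
ChromaticallyInvariant G = ∀ k → P₂ G k ≡ PΓ G k

Independent : ∀ {n} → TwoEdgeColouredGraph n → Subset n → Set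
Independent G I = ∀ x y → x ∈ I → y ∈ I → edge G x y ≡ false

InducedMonochromatic : ∀ {n} → TwoEdgeColouredGraph n → Subset n → Set
InducedMonochromatic G S =
  (∀ x y → x ∈ S → y ∈ S → red G x y ≡ false) ⊎
  (∀ x y → x ∈ S → y ∈ S → blue G x y ≡ false)

module Submission where

-- Proof idea.  Every k-colouring of G is a proper colouring of Γ, so
-- P(G,k) ≤ P(Γ,k), with equality iff every proper colouring of Γ respects
-- the red/blue condition.
--
-- (⇐) Let c be proper and suppose a red edge ux and a blue edge vy satisfy
--     c(u) = c(v), c(x) = c(y).  The colour classes I₁ = c⁻¹(c u) and
--     I₂ = c⁻¹(c x) are disjoint, non-empty and independent, and I₁ ∪ I₂
--     contains both edges, so it is not monochromatic.
-- (⇒) If I₁ ∪ I₂ contains a red and a blue edge, each of them joins I₁ to I₂.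
--     Colouring I₁ with 0, I₂ with 1 and every other vertex w with 2 + w
--     gives a proper (2+n)-colouring of Γ that is not a colouring of G,
--     hence P(G, 2+n) < P(Γ, 2+n).

open import Defs
open import Data.Nat using (ℕ; suc; _<_)
open import Data.Nat.Properties using (<-irrefl)
open import Data.Bool using (Bool; true; false)
open import Data.Bool.Properties using (¬-not) renaming (_≟_ to _≟ᵇ_)
open import Data.Fin using (Fin; zero; suc; _≟_)
open import Data.Fin.Properties using (any?)
open import Data.Fin.Subset using (Subset; Nonempty; Empty; _∪_; _∩_; _∈_)
open import Data.Fin.Subset.Properties using (_∈?_; x∈p∪q⁻; x∈p∪q⁺; x∈p∩q⁺; x∈p∩q⁻)
open import Data.List using ([]; _∷_; filter; length)
open import Data.List.Properties using (filter-reject; filter-notAll; filter-≐)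
open import Data.List.Relation.Unary.Any as Any using (Any; here)
open import Data.List.Relation.Unary.Any.Properties using (concatMap⁺; map⁺)
open import Data.List.Membership.Propositional using (find) renaming (_∈_ to _∈ₗ_)
open import Data.List.Membership.Propositional.Properties using (∈-allFin; ∈-filter⁺)
open import Data.Vec using (tabulate)
open import Data.Vec.Properties using (lookup⇒[]=; []=⇒lookup; lookup∘tabulate)
open import Data.Vec.Functional as VF using ()
open import Data.Product using (_×_; _,_; ∃; proj₁)
open import Data.Sum as Sum using (_⊎_; inj₁; inj₂)
open import Data.Empty using (⊥)
open import Function using (_∘_)
open import Function.Bundles using (_⇔_; mk⇔)
open import Relation.Nullary using (¬_; Dec; yes; no; does; contradiction)
open import Relation.Nullary.Decidable using (_×-dec_; dec-true)
open import Relation.Unary using (Decidable)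
open import Relation.Binary.PropositionalEquality
  using (_≡_; _≢_; _≗_; refl; sym; trans; cong; subst)

module _ {A : Set} {P Q : A → Set} (P? : Decidable P) (Q? : Decidable Q)
         (P⇒Q : ∀ x → P x → Q x) where

  filter-absorb : ∀ xs → filter P? (filter Q? xs) ≡ filter P? xs
  filter-absorb [] = refl
  filter-absorb (x ∷ xs) with Q? x
  ... | no ¬q = trans (filter-absorb xs) (sym (filter-reject P? (¬q ∘ P⇒Q x)))
  ... | yes _ with P? x
  ...   | yes _ = cong (x ∷_) (filter-absorb xs)
  ...   | no _  = filter-absorb xs

  count-strict : ∀ {x} xs → x ∈ₗ xs → Q x → ¬ P x →
                 length (filter P? xs) < length (filter Q? xs)
  count-strict xs x∈xs qx ¬px =
    subst (_< length (filter Q? xs)) (cong length (filter-absorb xs))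
      (filter-notAll P? (filter Q? xs)
        (Any.map (λ { refl → ¬px }) (∈-filter⁺ Q? x∈xs qx)))

allFuns-complete : ∀ n k (c : Fin n → Fin k) → Any (_≗ c) (allFuns n k)
allFuns-complete 0 k c = here (λ ())
allFuns-complete (suc n) k c =
  concatMap⁺ _ (Any.map (λ { refl → map⁺ (Any.map extend tail) }) (∈-allFin (c zero)))
  where
  tail : Any (_≗ c ∘ suc) (allFuns n k)
  tail = allFuns-complete n k (c ∘ suc)
  extend : ∀ {f} → f ≗ c ∘ suc → (c zero VF.∷ f) ≗ c
  extend f≗ zero    = refl
  extend f≗ (suc i) = f≗ i

tag : ∀ {A : Set} {m} → Dec A → Fin m → Fin (suc m)
tag (yes _) r = zero
tag (no _)  r = suc r

tag-yes : ∀ {A : Set} {m} (d : Dec A) {r : Fin m} → A → tag d r ≡ zero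
tag-yes (yes _) _ = refl
tag-yes (no ¬a) a = contradiction a ¬a

tag-no : ∀ {A : Set} {m} (d : Dec A) {r : Fin m} → ¬ A → tag d r ≡ suc r
tag-no (yes a) ¬a = contradiction a ¬a
tag-no (no _)  _  = refl

tag-≡ : ∀ {A B : Set} {m} (d : Dec A) (e : Dec B) {r s : Fin m} →
        tag d r ≡ tag e s → (A × B) ⊎ r ≡ s
tag-≡ (yes a) (yes b) _    = inj₁ (a , b)
tag-≡ (yes _) (no _)  ()
tag-≡ (no _)  (yes _) ()
tag-≡ (no _)  (no _)  refl = inj₂ refl

-- The separating colouring of two vertex sets: colour 0 on I₁, colour 1 on
-- I₂ ∖ I₁, and a private colour 2 + w for every other vertex w.
separating : ∀ {n} → Subset n → Subset n → Fin n → Fin (suc (suc n))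
separating I₁ I₂ w = tag (w ∈? I₁) (tag (w ∈? I₂) w)

module _ {n : ℕ} (I₁ I₂ : Subset n) where

  separating-≡ : ∀ {x y} → separating I₁ I₂ x ≡ separating I₁ I₂ y →
                 (x ∈ I₁ × y ∈ I₁) ⊎ (x ∈ I₂ × y ∈ I₂) ⊎ x ≡ y
  separating-≡ {x} {y} e =
    Sum.map₂ (tag-≡ (x ∈? I₂) (y ∈? I₂)) (tag-≡ (x ∈? I₁) (y ∈? I₁) e)

  separating-on₁ : ∀ {x y} → x ∈ I₁ → y ∈ I₁ → separating I₁ I₂ x ≡ separating I₁ I₂ y
  separating-on₁ {x} {y} x∈ y∈ = trans (tag-yes (x ∈? I₁) x∈) (sym (tag-yes (y ∈? I₁) y∈))

  separating-on₂ : Empty (I₁ ∩ I₂) →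
                   ∀ {x y} → x ∈ I₂ → y ∈ I₂ → separating I₁ I₂ x ≡ separating I₁ I₂ y
  separating-on₂ disj {x} {y} x∈ y∈ = trans (on₂ x∈) (sym (on₂ y∈))
    where
    on₂ : ∀ {w} → w ∈ I₂ → separating I₁ I₂ w ≡ suc zero
    on₂ {w} w∈ = trans (tag-no (w ∈? I₁) (λ w∈₁ → disj (w , x∈p∩q⁺ (w∈₁ , w∈))))
                       (cong suc (tag-yes (w ∈? I₂) w∈))

colourClass : ∀ {n k} → (Fin n → Fin k) → Fin k → Subset n
colourClass c a = tabulate (λ w → does (c w ≟ a))

∈-colourClass : ∀ {n k} (c : Fin n → Fin k) {a w} → c w ≡ a → w ∈ colourClass c a
∈-colourClass c {a} {w} cw≡a =
  lookup⇒[]= w _ (trans (lookup∘tabulate _ w) (dec-true (c w ≟ a) cw≡a))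

colourClass-∈ : ∀ {n k} (c : Fin n → Fin k) {a w} → w ∈ colourClass c a → c w ≡ a
colourClass-∈ c {a} {w} w∈ = decided (c w ≟ a) (trans (sym (lookup∘tabulate _ w)) ([]=⇒lookup w∈))
  where
  decided : ∀ {A : Set} (d : Dec A) → does d ≡ true → A
  decided (yes a) _ = a
  decided (no _) ()

colourClass-disjoint : ∀ {n k} (c : Fin n → Fin k) {a b} → a ≢ b →
                       Empty (colourClass c a ∩ colourClass c b)
colourClass-disjoint c a≢b (w , w∈) with x∈p∩q⁻ _ _ w∈
... | w∈a , w∈b = a≢b (trans (sym (colourClass-∈ c w∈a)) (colourClass-∈ c w∈b))

module _ {n : ℕ} (G : TwoEdgeColouredGraph n) where

  red⇒edge : ∀ {x y} → red G x y ≡ true → edge G x y ≡ true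
  red⇒edge r rewrite r = refl

  blue⇒edge : ∀ {x y} → blue G x y ≡ true → edge G x y ≡ true
  blue⇒edge {x} {y} b with red G x y
  ... | true  = refl
  ... | false = b

  edge-irr : ∀ x → edge G x x ≡ false
  edge-irr x rewrite red-irr G x | blue-irr G x = refl

  Proper-resp : ∀ {k} {f g : Fin n → Fin k} → f ≗ g → Proper G f → Proper G g
  Proper-resp f≗g p x y e gx≡gy = p x y e (trans (f≗g x) (trans gx≡gy (sym (f≗g y))))

  IsColouring-resp : ∀ {k} {f g : Fin n → Fin k} → f ≗ g → IsColouring G f → IsColouring G g
  IsColouring-resp f≗g (p , q) = Proper-resp f≗g p , λ u x v y r b gu≡gv gx≡gy →
    q u x v y r b (trans (f≗g u) (trans gu≡gv (sym (f≗g v))))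
                  (trans (f≗g x) (trans gx≡gy (sym (f≗g y))))

  colourClass-independent : ∀ {k} (c : Fin n → Fin k) → Proper G c →
                            ∀ a → Independent G (colourClass c a)
  colourClass-independent c p a x y x∈ y∈ = ¬-not λ e →
    p x y e (trans (colourClass-∈ c x∈) (sym (colourClass-∈ c y∈)))

  IndependentPairsMonochromatic : Set
  IndependentPairsMonochromatic = ∀ (I₁ I₂ : Subset n) → Independent G I₁ → Independent G I₂ →
    Nonempty I₁ → Nonempty I₂ → Empty (I₁ ∩ I₂) → InducedMonochromatic G (I₁ ∪ I₂)

  -- (⇐) A red edge ux and blue edge vy violating the condition for a proper
  -- colouring c lie in the union of the classes of c(u) and c(x).
  proper⇒colouring : IndependentPairsMonochromatic →
                     ∀ {k} (c : Fin n → Fin k) → Proper G c → IsColouring G c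
  proper⇒colouring mono c p = p , respects
    where
    inˡ : ∀ {a b w} → c w ≡ a → w ∈ colourClass c a ∪ colourClass c b
    inˡ e = x∈p∪q⁺ (inj₁ (∈-colourClass c e))
    inʳ : ∀ {a b w} → c w ≡ b → w ∈ colourClass c a ∪ colourClass c b
    inʳ e = x∈p∪q⁺ (inj₂ (∈-colourClass c e))
    respects : ∀ u x v y → red G u x ≡ true → blue G v y ≡ true → c u ≡ c v → c x ≢ c y
    respects u x v y r b cu≡cv cx≡cy
      with mono (colourClass c (c u)) (colourClass c (c x))
                (colourClass-independent c p (c u)) (colourClass-independent c p (c x))
                (u , ∈-colourClass c refl) (x , ∈-colourClass c refl)
                (colourClass-disjoint c (p u x (red⇒edge r)))
    ... | inj₁ noRed  with () ← trans (sym r) (noRed u x (inˡ refl) (inʳ refl))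
    ... | inj₂ noBlue with () ← trans (sym b) (noBlue v y (inˡ (sym cu≡cv)) (inʳ (sym cx≡cy)))

  invariant-if : IndependentPairsMonochromatic → ChromaticallyInvariant G
  invariant-if mono k =
    cong length (filter-≐ (isColouring? G) (proper? G) (proj₁ , proper⇒colouring mono _) (allFuns n k))

  crossing : ∀ {I₁ I₂} → Independent G I₁ → Independent G I₂ →
             (col : Fin n → Fin n → Bool) → (∀ x y → col x y ≡ col y x) →
             (∀ {x y} → col x y ≡ true → edge G x y ≡ true) →
             ∀ {x y} → x ∈ I₁ ∪ I₂ → y ∈ I₁ ∪ I₂ → col x y ≡ true →
             ∃ λ a → ∃ λ b → a ∈ I₁ × b ∈ I₂ × col a b ≡ true
  crossing {I₁} {I₂} i₁ i₂ col sym-col col⇒edge {x} {y} x∈ y∈ cxy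
    with x∈p∪q⁻ I₁ I₂ x∈ | x∈p∪q⁻ I₁ I₂ y∈
  ... | inj₁ x∈₁ | inj₁ y∈₁ with () ← trans (sym (col⇒edge cxy)) (i₁ x y x∈₁ y∈₁)
  ... | inj₁ x∈₁ | inj₂ y∈₂ = x , y , x∈₁ , y∈₂ , cxy
  ... | inj₂ x∈₂ | inj₁ y∈₁ = y , x , y∈₁ , x∈₂ , trans (sym-col y x) cxy
  ... | inj₂ x∈₂ | inj₂ y∈₂ with () ← trans (sym (col⇒edge cxy)) (i₂ x y x∈₂ y∈₂)

  separating-proper : ∀ {I₁ I₂} → Independent G I₁ → Independent G I₂ →
                      Proper G (separating I₁ I₂)
  separating-proper {I₁} {I₂} i₁ i₂ x y exy same with separating-≡ I₁ I₂ same
  ... | inj₁ (x∈ , y∈)        with () ← trans (sym exy) (i₁ x y x∈ y∈)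
  ... | inj₂ (inj₁ (x∈ , y∈)) with () ← trans (sym exy) (i₂ x y x∈ y∈)
  ... | inj₂ (inj₂ refl)      with () ← trans (sym exy) (edge-irr x)

  -- A red and a blue edge inside the union of two disjoint independent sets
  -- make the separating colouring a proper colouring of Γ that is not a
  -- colouring of G, so there are strictly fewer (2+n)-colourings of G.
  mixed⇒fewer : ∀ {I₁ I₂} → Independent G I₁ → Independent G I₂ → Empty (I₁ ∩ I₂) →
                ∀ {u x v y} → u ∈ I₁ ∪ I₂ → x ∈ I₁ ∪ I₂ → v ∈ I₁ ∪ I₂ → y ∈ I₁ ∪ I₂ →
                red G u x ≡ true → blue G v y ≡ true →
                P₂ G (suc (suc n)) < PΓ G (suc (suc n))
  mixed⇒fewer {I₁} {I₂} i₁ i₂ disj u∈ x∈ v∈ y∈ rux bvy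
    with crossing i₁ i₂ (red G) (red-sym G) red⇒edge u∈ x∈ rux
       | crossing i₁ i₂ (blue G) (blue-sym G) blue⇒edge v∈ y∈ bvy
       | find (allFuns-complete n (suc (suc n)) (separating I₁ I₂))
  ... | a , b , a∈ , b∈ , rab | d , e , d∈ , e∈ , bde | f , f∈ , f≗c =
    count-strict (isColouring? G) (proper? G) (λ _ → proj₁) (allFuns n _) f∈
      (Proper-resp (sym ∘ f≗c) (separating-proper i₁ i₂))
      (not-colouring ∘ IsColouring-resp f≗c)
    where
    not-colouring : ¬ IsColouring G (separating I₁ I₂)
    not-colouring (_ , respects) =
      respects a b d e rab bde (separating-on₁ I₁ I₂ a∈ d∈) (separating-on₂ I₁ I₂ disj b∈ e∈)

  unmixed⇒monochromatic : ∀ S → (∀ {u x v y} → u ∈ S → x ∈ S → v ∈ S → y ∈ S →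
                            red G u x ≡ true → blue G v y ≡ true → ⊥) →
                          InducedMonochromatic G S
  unmixed⇒monochromatic S unmixed
    with any? (λ u → any? (λ x → (u ∈? S) ×-dec (x ∈? S) ×-dec (red G u x ≟ᵇ true)))
  ... | yes (u , x , u∈ , x∈ , r) = inj₂ λ v y v∈ y∈ → ¬-not (unmixed u∈ x∈ v∈ y∈ r)
  ... | no noRed = inj₁ λ v y v∈ y∈ → ¬-not λ r → noRed (v , y , v∈ , y∈ , r)

  monochromatic-if : ChromaticallyInvariant G → IndependentPairsMonochromatic
  monochromatic-if inv I₁ I₂ i₁ i₂ _ _ disj = unmixed⇒monochromatic (I₁ ∪ I₂)
    λ u∈ x∈ v∈ y∈ r b → <-irrefl (inv (suc (suc n))) (mixed⇒fewer i₁ i₂ disj u∈ x∈ v∈ y∈ r b)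

theorem8 : ∀ {n : ℕ} (G : TwoEdgeColouredGraph n) →
    ChromaticallyInvariant G ⇔
      (∀ (I₁ I₂ : Subset n) → Independent G I₁ → Independent G I₂ →
        Nonempty I₁ → Nonempty I₂ → Empty (I₁ ∩ I₂) →
        InducedMonochromatic G (I₁ ∪ I₂))
theorem8 G = mk⇔ (monochromatic-if G) (invariant-if G)
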